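{- Let $n$ be a positive integer. There exist positive integers $a,b$ such that $(a,b,n,n)$ is a rectangular donut if and only if there exist relatively prime positive divisors $p$ and $q$ of $n$ with $p < q < 2p$.
   Context: All numbers are positive integers. A rectangular donut is an ordered quadruple $(a,b,x,y)$ of positive integers such that $1 < b \le a < ab$, $ab = 2xy$, $1 \le x < a$ and $1 \le y < b$. (Geometrically: an $a\times b$ rectangle containing an $x \times y$ rectangle with parallel sides, the larger rectangle having twice the area of the smaller.) A donut of the form $(a,b,n,n)$ is called square-holed. -}

module Defs where

open import Data.Nat using (ℕ; _*_; _<_; _≤_)
open import Data.Product using (_×_)
open import Relation.Binary.PropositionalEquality using (_≡_)

RectDonut : ℕ → ℕ → ℕ → ℕ → Set
RectDonut a b x y =
  (1 ≤ a) × (1 ≤ b) × (1 ≤ x) × (1 ≤ y) ×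
  (1 < b) × (b ≤ a) × (a < a * b) ×
  (a * b ≡ 2 * (x * y)) ×
  (x < a) × (y < b)

-- Write n = v g and a = u g with g = gcd(a, n), so that u and v are coprime. From
-- ab = 2n² one gets u b = 2 v n, hence u ∣ 2g, and the bounds n < a, n < b become
-- v < u < 2v. If u is odd then u ∣ g, and (v, u) is the required pair of divisors;
-- if u = 2k then k ∣ g, and (k, v) is. Conversely, coprime divisors p < q < 2p of n
-- give n = jpq, and a = 2p²j, b = q²j satisfy ab = 2n² with a, b > n.
module Submission where

open import Defs
open import Data.Nat
  using (ℕ; zero; suc; _+_; _*_; _<_; _≤_; z≤n; s≤s; NonZero; >-nonZero)
open import Data.Nat.Properties
open import Data.Nat.Divisibility
  using (_∣_; divides; ∣-trans; m∣m*n; n∣m*n; *-cancelˡ-∣; ∣1⇒≡1)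
open import Data.Nat.Coprimality using (Coprime; coprime-divisor; coprime-+; GCD≡1⇒coprime)
import Data.Nat.Coprimality as Coprime
open import Data.Nat.GCD using (gcd; gcd-GCD; GCD; GCD-*)
open import Data.Nat.Tactic.RingSolver using (solve)
open import Data.List using (_∷_; [])
open import Data.Product using (_×_; ∃-syntax; _,_)
open import Data.Sum using (_⊎_; inj₁; inj₂)
open import Function.Bundles using (_⇔_; mk⇔)
import Function.Properties.Equivalence as ⇔
open import Relation.Binary.PropositionalEquality

HasSquareHoledDonut : ℕ → Set
HasSquareHoledDonut n = ∃[ a ] ∃[ b ] (1 ≤ a × 1 ≤ b × RectDonut a b n n)

HasCloseCoprimeDivisors : ℕ → Set
HasCloseCoprimeDivisors n =
  ∃[ p ] ∃[ q ] (1 ≤ p × 1 ≤ q × p ∣ n × q ∣ n × Coprime p q × p < q × q < 2 * p)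

TwiceSquareFactorisation : ℕ → Set
TwiceSquareFactorisation n = ∃[ a ] ∃[ b ] (n < a × n < b × a * b ≡ 2 * (n * n))

rectDonut : ∀ {a b x y} → 1 ≤ x → 1 ≤ y → x < a → y < b → b ≤ a →
            a * b ≡ 2 * (x * y) → RectDonut a b x y
rectDonut {a} {b} 1≤x 1≤y x<a y<b b≤a ab≡2xy =
  1≤a , <⇒≤ 1<b , 1≤x , 1≤y , 1<b , b≤a , m<m*n a b {{>-nonZero 1≤a}} 1<b , ab≡2xy , x<a , y<b
  where
  1≤a : 1 ≤ a
  1≤a = ≤-trans 1≤x (<⇒≤ x<a)
  1<b : 1 < b
  1<b = ≤-trans (s≤s 1≤y) y<b

squareHoledDonut⇔twiceSquareFactorisation :
  ∀ {n} → 1 ≤ n → HasSquareHoledDonut n ⇔ TwiceSquareFactorisation n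
squareHoledDonut⇔twiceSquareFactorisation {n} 1≤n = mk⇔ toFactorisation fromFactorisation
  where
  toFactorisation : HasSquareHoledDonut n → TwiceSquareFactorisation n
  toFactorisation (a , b , _ , _ , _ , _ , _ , _ , _ , _ , _ , ab≡2nn , n<a , n<b) =
    a , b , n<a , n<b , ab≡2nn

  donut : ∀ {a b} → n < a → n < b → b ≤ a → a * b ≡ 2 * (n * n) → HasSquareHoledDonut n
  donut {a} {b} n<a n<b b≤a ab≡2nn =
    a , b , ≤-trans 1≤n (<⇒≤ n<a) , ≤-trans 1≤n (<⇒≤ n<b) , rectDonut 1≤n 1≤n n<a n<b b≤a ab≡2nn

  fromFactorisation : TwiceSquareFactorisation n → HasSquareHoledDonut n
  fromFactorisation (a , b , n<a , n<b , ab≡2nn) with ≤-total b a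
  ... | inj₁ b≤a = donut n<a n<b b≤a ab≡2nn
  ... | inj₂ a≤b = donut n<b n<a a≤b (trans (*-comm b a) ab≡2nn)

closeFactors⇒twiceSquareFactorisation :
  ∀ p q j → 1 ≤ j * q * p → p < q → q < 2 * p → TwiceSquareFactorisation (j * q * p)
closeFactors⇒twiceSquareFactorisation p q j 1≤n p<q q<2p =
  2 * (p * (p * j)) , q * (q * j) , n<a , n<b , solve (p ∷ q ∷ j ∷ [])
  where
  open ≤-Reasoning
  jq≢0 : NonZero (j * q)
  jq≢0 = m*n≢0⇒m≢0 (j * q) {{>-nonZero 1≤n}}
  instance
    p≢0 : NonZero p
    p≢0 = m*n≢0⇒n≢0 (j * q) {{>-nonZero 1≤n}}
    q≢0 : NonZero q
    q≢0 = >-nonZero (≤-<-trans z≤n p<q)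
    j≢0 : NonZero j
    j≢0 = m*n≢0⇒m≢0 j {{jq≢0}}
  n<a : j * q * p < 2 * (p * (p * j))
  n<a = begin-strict
    j * q * p          ≡⟨ solve (p ∷ q ∷ j ∷ []) ⟩
    q * (p * j)        <⟨ *-monoˡ-< (p * j) {{m*n≢0 p j}} q<2p ⟩
    2 * p * (p * j)    ≡⟨ *-assoc 2 p (p * j) ⟩
    2 * (p * (p * j))  ∎
  n<b : j * q * p < q * (q * j)
  n<b = begin-strict
    j * q * p    ≡⟨ solve (p ∷ q ∷ j ∷ []) ⟩
    p * (q * j)  <⟨ *-monoˡ-< (q * j) {{m*n≢0 q j}} p<q ⟩
    q * (q * j)  ∎

closeCoprimeDivisors⇒twiceSquareFactorisation :
  ∀ {n} → 1 ≤ n → HasCloseCoprimeDivisors n → TwiceSquareFactorisation n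
closeCoprimeDivisors⇒twiceSquareFactorisation 1≤n
  (p , q , _ , _ , divides k refl , q∣kp , p⊥q , p<q , q<2p)
  with coprime-divisor (Coprime.sym p⊥q) (subst (q ∣_) (*-comm k p) q∣kp)
... | divides j refl = closeFactors⇒twiceSquareFactorisation p q j 1≤n p<q q<2p

even-or-odd : ∀ u → (∃[ k ] u ≡ k * 2) ⊎ (∃[ k ] u ≡ 1 + k * 2)
even-or-odd zero          = inj₁ (0 , refl)
even-or-odd (suc zero)    = inj₂ (0 , refl)
even-or-odd (suc (suc u)) with even-or-odd u
... | inj₁ (k , refl) = inj₁ (suc k , refl)
... | inj₂ (k , refl) = inj₂ (suc k , refl)

odd-coprime-2 : ∀ k → Coprime (1 + k * 2) 2
odd-coprime-2 zero    (d∣1 , _) = ∣1⇒≡1 d∣1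
odd-coprime-2 (suc k) = coprime-+ (odd-coprime-2 k)

coprime-cofactors : ∀ {u v g} .{{_ : NonZero g}} → GCD (u * g) (v * g) g → Coprime u v
coprime-cofactors {g = g} G = GCD≡1⇒coprime (GCD-* (subst (GCD _ _) (sym (*-identityˡ g)) G))

closeCofactors⇒closeCoprimeDivisors : ∀ {u v g} → Coprime u v → v < u → u < 2 * v →
                                       u ∣ 2 * g → HasCloseCoprimeDivisors (v * g)
closeCofactors⇒closeCoprimeDivisors {v = zero} _ _ () _
closeCofactors⇒closeCoprimeDivisors {u} {suc v} {g} u⊥v v<u u<2v u∣2g with even-or-odd u
... | inj₂ (k , refl) =
  suc v , u , s≤s z≤n , ≤-trans (s≤s z≤n) v<u , m∣m*n g , ∣-trans u∣g (n∣m*n (suc v)) ,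
  Coprime.sym u⊥v , v<u , u<2v
  where
  u∣g : u ∣ g
  u∣g = coprime-divisor (odd-coprime-2 k) u∣2g
... | inj₁ (zero , refl) with () ← v<u
... | inj₁ (k@(suc _) , refl) =
  k , suc v , s≤s z≤n , s≤s z≤n , ∣-trans k∣g (n∣m*n (suc v)) , m∣m*n g , k⊥v , k<v ,
  subst (suc v <_) (*-comm k 2) v<u
  where
  k∣g : k ∣ g
  k∣g = *-cancelˡ-∣ 2 (subst (_∣ 2 * g) (*-comm k 2) u∣2g)
  k⊥v : Coprime k (suc v)
  k⊥v (d∣k , d∣v) = u⊥v (∣-trans d∣k (m∣m*n 2) , d∣v)
  k<v : k < suc v
  k<v = *-cancelˡ-< 2 k (suc v) (subst (_< 2 * suc v) (*-comm k 2) u<2v)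

coprimeFactorisation⇒closeCoprimeDivisors :
  ∀ {u v g b} .{{_ : NonZero g}} → Coprime u v → v * g < u * g → v * g < b →
  u * g * b ≡ 2 * (v * g * (v * g)) → HasCloseCoprimeDivisors (v * g)
coprimeFactorisation⇒closeCoprimeDivisors {u} {v} {g} {b} u⊥v n<a n<b ab≡2nn =
  closeCofactors⇒closeCoprimeDivisors u⊥v v<u u<2v u∣2g
  where
  v<u : v < u
  v<u = *-cancelʳ-< g v u n<a
  ub≡2vn : u * b ≡ 2 * v * (v * g)
  ub≡2vn = *-cancelʳ-≡ (u * b) (2 * v * (v * g)) g (begin
    u * b * g                  ≡⟨ solve (u ∷ g ∷ b ∷ []) ⟩
    u * g * b                  ≡⟨ ab≡2nn ⟩
    2 * (v * g * (v * g))      ≡⟨ solve (v ∷ g ∷ []) ⟩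
    2 * v * (v * g) * g        ∎)
    where open ≡-Reasoning
  u<2v : u < 2 * v
  u<2v = *-cancelʳ-< (v * g) u (2 * v) (begin-strict
    u * (v * g)      <⟨ *-monoʳ-< u {{>-nonZero (≤-<-trans z≤n v<u)}} n<b ⟩
    u * b            ≡⟨ ub≡2vn ⟩
    2 * v * (v * g)  ∎)
    where open ≤-Reasoning
  u∣2g : u ∣ 2 * g
  u∣2g = coprime-divisor u⊥v (coprime-divisor u⊥v (divides b (begin
    v * (v * (2 * g))  ≡⟨ solve (v ∷ g ∷ []) ⟩
    2 * v * (v * g)    ≡⟨ sym ub≡2vn ⟩
    u * b              ≡⟨ *-comm u b ⟩
    b * u              ∎)))
    where open ≡-Reasoning

twiceSquareFactorisation⇒closeCoprimeDivisors :
  ∀ {n} → 1 ≤ n → TwiceSquareFactorisation n → HasCloseCoprimeDivisors n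
twiceSquareFactorisation⇒closeCoprimeDivisors {n} 1≤n (a , b , n<a , n<b , ab≡2nn)
  with gcd a n | gcd-GCD a n
... | g | G with GCD.commonDivisor G
... | divides u refl , divides v refl =
  coprimeFactorisation⇒closeCoprimeDivisors {u} {v} {{g≢0}} (coprime-cofactors {{g≢0}} G) n<a n<b ab≡2nn
  where
  g≢0 : NonZero g
  g≢0 = m*n≢0⇒n≢0 v {{>-nonZero 1≤n}}

theorem3 : (n : ℕ) → 1 ≤ n →
    (∃[ a ] ∃[ b ] (1 ≤ a × 1 ≤ b × RectDonut a b n n))
    ⇔ (∃[ p ] ∃[ q ] (1 ≤ p × 1 ≤ q × p ∣ n × q ∣ n × Coprime p q × p < q × q < 2 * p))
theorem3 n 1≤n =
  ⇔.trans (squareHoledDonut⇔twiceSquareFactorisation 1≤n)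
          (mk⇔ (twiceSquareFactorisation⇒closeCoprimeDivisors 1≤n)
               (closeCoprimeDivisors⇒twiceSquareFactorisation 1≤n))
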